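{- Let $A$, $B$ and $C_1,\dots,C_k$ be types. If $A\le^s B$, then $[[A,C_1,\dots,C_k]]\le^a[[B,C_1,\dots,C_k]]$.
   Context: Simply typed $\lambda$-calculus over base type $0$; every type is uniquely $[A_1,\dots,A_n]:=A_1\to\cdots\to A_n\to0$. A context $\Gamma=x_1^{C_1},\dots,x_k^{C_k}$ is a finite list of distinct typed variables, $\{\Gamma\}$ its set, $[\Gamma]:=[C_1,\dots,C_k]$; terms identified up to $\beta\eta$ ($=_{\beta\eta}$); $\Lambda^\Xi(A)$ = terms of type $A$ with free variables in $\{\Xi\}$. A substitution $\varrho$ from $\Gamma$ to $\Delta$ assigns $\varrho_c\in\Lambda^\Delta(C)$ to each $c^C\in\{\Gamma\}$; for a fresh context $\Xi$, $\varrho^\Xi$ is $\varrho$ on $\{\Gamma\}$ and the identity on $\{\Xi\}$, and $\hat\varrho^\Xi\colon\Lambda^{\Xi,\Gamma}(0)\to\Lambda^{\Xi,\Delta}(0)$, $M\mapsto M[\Gamma:=\varrho]$. For types, $[\Gamma]\le^s[\Delta]$ means there is a substitution $\varrho$ from $\Gamma$ to $\Delta$ with $\hat\varrho^\Xi$ injective for every fresh context $\Xi$. $\varrho$ is an atomic reduction if for every fresh $\Xi$, all $a^A,b^B\in\{\Xi,\Gamma\}$ with $A\equiv[A_1,\dots,A_n]$, $B\equiv[B_1,\dots,B_m]$, and all $M_i\in\Lambda^{\Xi,\Delta}(A_i)$, $N_i\in\Lambda^{\Xi,\Delta}(B_i)$: $\varrho^\Xi_aM_1\cdots M_n=_{\beta\eta}\varrho^\Xi_bN_1\cdots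 N_m$ implies $a=b$ and all $M_i=N_i$; $[\Gamma]\le^a[\Delta]$ means an atomic reduction from $\Gamma$ to $\Delta$ exists. -}

module Defs where

open import Data.List using (List; []; _∷_; _++_; foldr)
open import Data.Product using (Σ)

-- Simple types over the single base type 0 (here ι)

infixr 7 _⇒_
data Ty : Set where
  ι   : Ty
  _⇒_ : Ty → Ty → Ty

Ctx : Set
Ctx = List Ty

⟦_⟧ : List Ty → Ty
⟦_⟧ = foldr _⇒_ ι

-- the unique list of argument types: A ≡ ⟦ args A ⟧
args : Ty → List Ty
args ι       = []
args (A ⇒ B) = A ∷ args B

infix 4 _∋_
data _∋_ : Ctx → Ty → Set where
  vz : ∀ {Γ A} → (A ∷ Γ) ∋ A
  vs : ∀ {Γ A B} → Γ ∋ A → (B ∷ Γ) ∋ A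

data Tm (Γ : Ctx) : Ty → Set where
  var : ∀ {A} → Γ ∋ A → Tm Γ A
  lam : ∀ {A B} → Tm (A ∷ Γ) B → Tm Γ (A ⇒ B)
  app : ∀ {A B} → Tm Γ (A ⇒ B) → Tm Γ A → Tm Γ B

Ren : Ctx → Ctx → Set
Ren Γ Δ = ∀ {A} → Γ ∋ A → Δ ∋ A

ext : ∀ {Γ Δ B} → Ren Γ Δ → Ren (B ∷ Γ) (B ∷ Δ)
ext ρ vz     = vz
ext ρ (vs x) = vs (ρ x)

ren : ∀ {Γ Δ A} → Ren Γ Δ → Tm Γ A → Tm Δ A
ren ρ (var x)   = var (ρ x)
ren ρ (lam t)   = lam (ren (ext ρ) t)
ren ρ (app t u) = app (ren ρ t) (ren ρ u)

Sub : Ctx → Ctx → Set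
Sub Γ Δ = ∀ {A} → Γ ∋ A → Tm Δ A

exts : ∀ {Γ Δ B} → Sub Γ Δ → Sub (B ∷ Γ) (B ∷ Δ)
exts σ vz     = var vz
exts σ (vs x) = ren vs (σ x)

sub : ∀ {Γ Δ A} → Sub Γ Δ → Tm Γ A → Tm Δ A
sub σ (var x)   = σ x
sub σ (lam t)   = lam (sub (exts σ) t)
sub σ (app t u) = app (sub σ t) (sub σ u)

sub0 : ∀ {Γ A B} → Tm (A ∷ Γ) B → Tm Γ A → Tm Γ B
sub0 {Γ} {A} t u = sub σ t
  where
  σ : Sub (A ∷ Γ) Γ
  σ vz     = u
  σ (vs x) = var x

infix 4 _≈_
data _≈_ {Γ : Ctx} : ∀ {A} → Tm Γ A → Tm Γ A → Set where
  ≈-refl  : ∀ {A} {t : Tm Γ A} → t ≈ t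
  ≈-sym   : ∀ {A} {t u : Tm Γ A} → t ≈ u → u ≈ t
  ≈-trans : ∀ {A} {t u v : Tm Γ A} → t ≈ u → u ≈ v → t ≈ v
  lam-cong : ∀ {A B} {t u : Tm (A ∷ Γ) B} → t ≈ u → lam t ≈ lam u
  app-cong : ∀ {A B} {t t′ : Tm Γ (A ⇒ B)} {u u′ : Tm Γ A} →
             t ≈ t′ → u ≈ u′ → app t u ≈ app t′ u′
  β : ∀ {A B} (t : Tm (A ∷ Γ) B) (u : Tm Γ A) → app (lam t) u ≈ sub0 t u
  η : ∀ {A B} (t : Tm Γ (A ⇒ B)) → t ≈ lam (app (ren vs t) (var vz))

-- Context extension by a fresh context Ξ: the context Ξ,Γ is Ξ ++ Γ.

liftSub : ∀ Ξ {Γ Δ} → Sub Γ Δ → Sub (Ξ ++ Γ) (Ξ ++ Δ)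
liftSub []      σ x      = σ x
liftSub (B ∷ Ξ) σ vz     = var vz
liftSub (B ∷ Ξ) σ (vs x) = ren vs (liftSub Ξ σ x)

hat : ∀ Ξ {Γ Δ} → Sub Γ Δ → Tm (Ξ ++ Γ) ι → Tm (Ξ ++ Δ) ι
hat Ξ ϱ M = sub (liftSub Ξ ϱ) M

IsInjRed : ∀ {Γ Δ} → Sub Γ Δ → Set
IsInjRed {Γ} {Δ} ϱ =
  ∀ Ξ (M N : Tm (Ξ ++ Γ) ι) → hat Ξ ϱ M ≈ hat Ξ ϱ N → M ≈ N

-- [Γ] ≤ˢ [Δ] ; on types via their unique argument lists
_≤ˢ_ : Ty → Ty → Set
A ≤ˢ B = Σ (Sub (args A) (args B)) IsInjRed

infixr 5 _∷_
data Args (Θ : Ctx) : List Ty → Set where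
  []  : Args Θ []
  _∷_ : ∀ {A As} → Tm Θ A → Args Θ As → Args Θ (A ∷ As)

data ArgsEq {Θ : Ctx} : ∀ {As} → Args Θ As → Args Θ As → Set where
  []  : ArgsEq [] []
  _∷_ : ∀ {A As} {M N : Tm Θ A} {Ms Ns : Args Θ As} →
        M ≈ N → ArgsEq Ms Ns → ArgsEq (M ∷ Ms) (N ∷ Ns)

apps : ∀ {Θ A} → Tm Θ A → Args Θ (args A) → Tm Θ ι
apps {A = ι}     t []       = t
apps {A = A ⇒ B} t (u ∷ us) = apps (app t u) us

-- "a = b and all Mᵢ = Nᵢ"
data SameHead {Θ Θ′ : Ctx} : ∀ {A B} → Θ ∋ A → Θ ∋ B →
              Args Θ′ (args A) → Args Θ′ (args B) → Set where
  same : ∀ {A} {a : Θ ∋ A} {Ms Ns : Args Θ′ (args A)} →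
         ArgsEq Ms Ns → SameHead a a Ms Ns

IsAtomicRed : ∀ {Γ Δ} → Sub Γ Δ → Set
IsAtomicRed {Γ} {Δ} ϱ =
  ∀ Ξ {A B} (a : (Ξ ++ Γ) ∋ A) (b : (Ξ ++ Γ) ∋ B)
    (Ms : Args (Ξ ++ Δ) (args A)) (Ns : Args (Ξ ++ Δ) (args B)) →
    apps (liftSub Ξ ϱ a) Ms ≈ apps (liftSub Ξ ϱ b) Ns →
    SameHead a b Ms Ns

_≤ᵃ_ : Ty → Ty → Set
A ≤ᵃ B = Σ (Sub (args A) (args B)) IsAtomicRed

{-# OPTIONS --safe #-}
-- An injective reduction σ from the arguments of A to those of B turns M : A
-- into precomp σ M = λ y⃗. M (σ y⃗) : B, and this map is injective up to βη
-- because σ̂ is. The atomic reduction sends x : [A, C⃗] to λ a. y (precomp σ a):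
-- variables of Ξ are left alone and x M N⃗ becomes y (precomp σ M) N⃗. Since
-- βη-equal spines have equal heads and pointwise βη-equal arguments (their
-- β-normal η-long forms, computed by normalisation by evaluation, coincide),
-- atomicity reduces to the injectivity of precomp σ.
module Submission where

open import Defs
open import Data.List using (List; []; _∷_; _++_; _ʳ++_)
open import Data.Product using (Σ; _,_; -,_; proj₁; proj₂; _×_)
open import Data.Empty using (⊥; ⊥-elim)
open import Level using (0ℓ)
open import Relation.Binary.Bundles using (Setoid)
import Relation.Binary.Reasoning.Setoid
open import Relation.Binary.PropositionalEquality

-- Renaming and substitution

infix 4 _≗ʳ_ _≗ˢ_

_≗ʳ_ : ∀ {Γ Δ} → Ren Γ Δ → Ren Γ Δ → Set
_≗ʳ_ {Γ} r r′ = ∀ {A} (x : Γ ∋ A) → r x ≡ r′ x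

_≗ˢ_ : ∀ {Γ Δ} → Sub Γ Δ → Sub Γ Δ → Set
_≗ˢ_ {Γ} s s′ = ∀ {A} (x : Γ ∋ A) → s x ≡ s′ x

ext-cong : ∀ {Γ Δ B} {r r′ : Ren Γ Δ} → r ≗ʳ r′ → ext {B = B} r ≗ʳ ext r′
ext-cong e vz     = refl
ext-cong e (vs x) = cong vs (e x)

ren-cong : ∀ {Γ Δ A} {r r′ : Ren Γ Δ} → r ≗ʳ r′ → (t : Tm Γ A) →
           ren r t ≡ ren r′ t
ren-cong e (var x)   = cong var (e x)
ren-cong e (lam t)   = cong lam (ren-cong (ext-cong e) t)
ren-cong e (app t u) = cong₂ app (ren-cong e t) (ren-cong e u)

ren-id : ∀ {Γ A} (t : Tm Γ A) → ren (λ x → x) t ≡ t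
ren-id (var x)   = refl
ren-id (lam t)   = cong lam (trans (ren-cong (λ { vz → refl ; (vs x) → refl }) t) (ren-id t))
ren-id (app t u) = cong₂ app (ren-id t) (ren-id u)

ren-ren : ∀ {Γ Δ Θ A} (r : Ren Γ Δ) (r′ : Ren Δ Θ) (t : Tm Γ A) →
          ren r′ (ren r t) ≡ ren (λ x → r′ (r x)) t
ren-ren r r′ (var x)   = refl
ren-ren r r′ (lam t)   = cong lam (trans (ren-ren (ext r) (ext r′) t)
                           (ren-cong (λ { vz → refl ; (vs x) → refl }) t))
ren-ren r r′ (app t u) = cong₂ app (ren-ren r r′ t) (ren-ren r r′ u)

exts-cong : ∀ {Γ Δ B} {s s′ : Sub Γ Δ} → s ≗ˢ s′ → exts {B = B} s ≗ˢ exts s′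
exts-cong e vz     = refl
exts-cong e (vs x) = cong (ren vs) (e x)

sub-cong : ∀ {Γ Δ A} {s s′ : Sub Γ Δ} → s ≗ˢ s′ → (t : Tm Γ A) →
           sub s t ≡ sub s′ t
sub-cong e (var x)   = e x
sub-cong e (lam t)   = cong lam (sub-cong (exts-cong e) t)
sub-cong e (app t u) = cong₂ app (sub-cong e t) (sub-cong e u)

sub-ren : ∀ {Γ Δ Θ A} (r : Ren Γ Δ) (s : Sub Δ Θ) (t : Tm Γ A) →
          sub s (ren r t) ≡ sub (λ x → s (r x)) t
sub-ren r s (var x)   = refl
sub-ren r s (lam t)   = cong lam (trans (sub-ren (ext r) (exts s) t)
                          (sub-cong (λ { vz → refl ; (vs x) → refl }) t))
sub-ren r s (app t u) = cong₂ app (sub-ren r s t) (sub-ren r s u)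

ren-sub : ∀ {Γ Δ Θ A} (s : Sub Γ Δ) (r : Ren Δ Θ) (t : Tm Γ A) →
          ren r (sub s t) ≡ sub (λ x → ren r (s x)) t
ren-sub s r (var x)   = refl
ren-sub s r (lam t)   = cong lam (trans (ren-sub (exts s) (ext r) t) (sub-cong exts-ext t))
  where
  exts-ext : (λ {A} x → ren (ext r) (exts s {A} x)) ≗ˢ exts (λ x → ren r (s x))
  exts-ext vz     = refl
  exts-ext (vs x) = trans (ren-ren vs (ext r) (s x)) (sym (ren-ren r vs (s x)))
ren-sub s r (app t u) = cong₂ app (ren-sub s r t) (ren-sub s r u)

sub-sub : ∀ {Γ Δ Θ A} (s : Sub Γ Δ) (s′ : Sub Δ Θ) (t : Tm Γ A) →
          sub s′ (sub s t) ≡ sub (λ x → sub s′ (s x)) t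
sub-sub s s′ (var x)   = refl
sub-sub s s′ (lam t)   = cong lam (trans (sub-sub (exts s) (exts s′) t) (sub-cong exts-exts t))
  where
  exts-exts : (λ {A} x → sub (exts s′) (exts s {A} x)) ≗ˢ exts (λ x → sub s′ (s x))
  exts-exts vz     = refl
  exts-exts (vs x) = trans (sub-ren vs (exts s′) (s x)) (sym (ren-sub s′ vs (s x)))
sub-sub s s′ (app t u) = cong₂ app (sub-sub s s′ t) (sub-sub s s′ u)

sub-var : ∀ {Γ Δ A} (r : Ren Γ Δ) (t : Tm Γ A) → sub (λ x → var (r x)) t ≡ ren r t
sub-var r (var x)   = refl
sub-var r (lam t)   = cong lam (trans (sub-cong (λ { vz → refl ; (vs x) → refl }) t)
                        (sub-var (ext r) t))
sub-var r (app t u) = cong₂ app (sub-var r t) (sub-var r u)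

sub-id : ∀ {Γ A} (t : Tm Γ A) → sub var t ≡ t
sub-id t = trans (sub-var (λ x → x) t) (ren-id t)

Tm-setoid : Ctx → Ty → Setoid 0ℓ 0ℓ
Tm-setoid Γ A = record
  { Carrier       = Tm Γ A
  ; _≈_           = _≈_
  ; isEquivalence = record { refl = ≈-refl ; sym = ≈-sym ; trans = ≈-trans }
  }

module ≈-Reasoning {Γ A} = Relation.Binary.Reasoning.Setoid (Tm-setoid Γ A)

≡⇒≈ : ∀ {Γ A} {t u : Tm Γ A} → t ≡ u → t ≈ u
≡⇒≈ refl = ≈-refl

ren-resp-≈ : ∀ {Γ Δ A} (r : Ren Γ Δ) {t u : Tm Γ A} → t ≈ u → ren r t ≈ ren r u
ren-resp-≈ r ≈-refl          = ≈-refl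
ren-resp-≈ r (≈-sym e)       = ≈-sym (ren-resp-≈ r e)
ren-resp-≈ r (≈-trans e e′)  = ≈-trans (ren-resp-≈ r e) (ren-resp-≈ r e′)
ren-resp-≈ r (lam-cong e)    = lam-cong (ren-resp-≈ (ext r) e)
ren-resp-≈ r (app-cong e e′) = app-cong (ren-resp-≈ r e) (ren-resp-≈ r e′)
ren-resp-≈ r (β t u)         = ≈-trans (β _ _) (≡⇒≈ (trans (sub-ren (ext r) _ t)
  (trans (sub-cong (λ { vz → refl ; (vs x) → refl }) t) (sym (ren-sub _ r t)))))
ren-resp-≈ r (η t)           = ≈-trans (η _) (lam-cong (app-cong
  (≡⇒≈ (trans (ren-ren r vs t) (sym (ren-ren vs (ext r) t)))) ≈-refl))

apps-resp-≈ : ∀ {Γ} A {t t′ : Tm Γ A} Ps → t ≈ t′ → apps t Ps ≈ apps t′ Ps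
apps-resp-≈ ι       []       e = e
apps-resp-≈ (A ⇒ B) (P ∷ Ps) e = apps-resp-≈ B Ps (app-cong e ≈-refl)

≈-resp : ∀ {Γ A} {t t′ u u′ : Tm Γ A} → t ≈ t′ → u ≈ u′ → t ≈ u → t′ ≈ u′
≈-resp et eu e = ≈-trans (≈-sym et) (≈-trans e eu)

β-var : ∀ {Γ A B} (t : Tm (A ∷ Γ) B) → app (ren vs (lam t)) (var vz) ≈ t
β-var t = ≈-trans (β _ (var vz)) (≡⇒≈ (trans (sub-ren (ext vs) _ t)
  (trans (sub-cong (λ { vz → refl ; (vs x) → refl }) t) (sub-id t))))

lam-injective : ∀ {Γ A B} {t u : Tm (A ∷ Γ) B} → lam t ≈ lam u → t ≈ u
lam-injective {t = t} {u} e =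
  ≈-trans (≈-sym (β-var t)) (≈-trans (app-cong (ren-resp-≈ vs e) ≈-refl) (β-var u))

-- Normalisation by evaluation

mutual
  data Ne (Γ : Ctx) : Ty → Set where
    nvar : ∀ {A} → Γ ∋ A → Ne Γ A
    napp : ∀ {A B} → Ne Γ (A ⇒ B) → Nf Γ A → Ne Γ B

  data Nf (Γ : Ctx) : Ty → Set where
    nne  : Ne Γ ι → Nf Γ ι
    nlam : ∀ {A B} → Nf (A ∷ Γ) B → Nf Γ (A ⇒ B)

mutual
  renNe : ∀ {Γ Δ A} → Ren Γ Δ → Ne Γ A → Ne Δ A
  renNe r (nvar x)   = nvar (r x)
  renNe r (napp n m) = napp (renNe r n) (renNf r m)

  renNf : ∀ {Γ Δ A} → Ren Γ Δ → Nf Γ A → Nf Δ A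
  renNf r (nne n)  = nne (renNe r n)
  renNf r (nlam m) = nlam (renNf (ext r) m)

mutual
  ⌜_⌝ne : ∀ {Γ A} → Ne Γ A → Tm Γ A
  ⌜ nvar x ⌝ne   = var x
  ⌜ napp n m ⌝ne = app ⌜ n ⌝ne ⌜ m ⌝

  ⌜_⌝ : ∀ {Γ A} → Nf Γ A → Tm Γ A
  ⌜ nne n ⌝  = ⌜ n ⌝ne
  ⌜ nlam m ⌝ = lam ⌜ m ⌝

mutual
  renNe-cong : ∀ {Γ Δ A} {r r′ : Ren Γ Δ} → r ≗ʳ r′ → (n : Ne Γ A) →
               renNe r n ≡ renNe r′ n
  renNe-cong e (nvar x)   = cong nvar (e x)
  renNe-cong e (napp n m) = cong₂ napp (renNe-cong e n) (renNf-cong e m)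

  renNf-cong : ∀ {Γ Δ A} {r r′ : Ren Γ Δ} → r ≗ʳ r′ → (m : Nf Γ A) →
               renNf r m ≡ renNf r′ m
  renNf-cong e (nne n)  = cong nne (renNe-cong e n)
  renNf-cong e (nlam m) = cong nlam (renNf-cong (ext-cong e) m)

mutual
  renNe-id : ∀ {Γ A} (n : Ne Γ A) → renNe (λ x → x) n ≡ n
  renNe-id (nvar x)   = refl
  renNe-id (napp n m) = cong₂ napp (renNe-id n) (renNf-id m)

  renNf-id : ∀ {Γ A} (m : Nf Γ A) → renNf (λ x → x) m ≡ m
  renNf-id (nne n)  = cong nne (renNe-id n)
  renNf-id (nlam m) = cong nlam (trans (renNf-cong (λ { vz → refl ; (vs x) → refl }) m)
                                   (renNf-id m))

mutual
  renNe-renNe : ∀ {Γ Δ Θ A} (r : Ren Γ Δ) (r′ : Ren Δ Θ) (n : Ne Γ A) →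
                renNe r′ (renNe r n) ≡ renNe (λ x → r′ (r x)) n
  renNe-renNe r r′ (nvar x)   = refl
  renNe-renNe r r′ (napp n m) = cong₂ napp (renNe-renNe r r′ n) (renNf-renNf r r′ m)

  renNf-renNf : ∀ {Γ Δ Θ A} (r : Ren Γ Δ) (r′ : Ren Δ Θ) (m : Nf Γ A) →
                renNf r′ (renNf r m) ≡ renNf (λ x → r′ (r x)) m
  renNf-renNf r r′ (nne n)  = cong nne (renNe-renNe r r′ n)
  renNf-renNf r r′ (nlam m) = cong nlam (trans (renNf-renNf (ext r) (ext r′) m)
                                (renNf-cong (λ { vz → refl ; (vs x) → refl }) m))

mutual
  ⌜renNe⌝ : ∀ {Γ Δ A} (r : Ren Γ Δ) (n : Ne Γ A) → ⌜ renNe r n ⌝ne ≡ ren r ⌜ n ⌝ne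
  ⌜renNe⌝ r (nvar x)   = refl
  ⌜renNe⌝ r (napp n m) = cong₂ app (⌜renNe⌝ r n) (⌜renNf⌝ r m)

  ⌜renNf⌝ : ∀ {Γ Δ A} (r : Ren Γ Δ) (m : Nf Γ A) → ⌜ renNf r m ⌝ ≡ ren r ⌜ m ⌝
  ⌜renNf⌝ r (nne n)  = ⌜renNe⌝ r n
  ⌜renNf⌝ r (nlam m) = cong lam (⌜renNf⌝ (ext r) m)

-- Values of function type are Kripke functions. Without function
-- extensionality they are compared by a partial equivalence: related functions
-- send related arguments to related results, and each commutes with renaming.

Val : Ctx → Ty → Set
Val Γ ι       = Nf Γ ι
Val Γ (A ⇒ B) = ∀ {Δ} → Ren Γ Δ → Val Δ A → Val Δ B

renV : ∀ {Γ Δ} A → Ren Γ Δ → Val Γ A → Val Δ A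
renV ι       w v = renNf w v
renV (A ⇒ B) w f = λ w′ a → f (λ x → w′ (w x)) a

EqV : ∀ {Γ} A → Val Γ A → Val Γ A → Set
Uniform : ∀ {Γ} A B → Val Γ (A ⇒ B) → Set

EqV ι       v v′ = v ≡ v′
EqV {Γ} (A ⇒ B) f g =
  (∀ {Δ} (w : Ren Γ Δ) {a b} → EqV A a b → EqV B (f w a) (g w b)) ×
  Uniform A B f × Uniform A B g

Uniform {Γ} A B f = ∀ {Δ Δ′} (w : Ren Γ Δ) (w′ : Ren Δ Δ′) a → EqV A a a →
  EqV B (renV B w′ (f w a)) (f (λ x → w′ (w x)) (renV A w′ a))

uniformˡ : ∀ {Γ A B} {f g : Val Γ (A ⇒ B)} → EqV (A ⇒ B) f g → Uniform A B f
uniformˡ (_ , uf , _) = uf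

EqV-sym : ∀ {Γ} A {a b : Val Γ A} → EqV A a b → EqV A b a
EqV-sym ι       e             = sym e
EqV-sym (A ⇒ B) (c , uf , ug) = (λ w e → EqV-sym B (c w (EqV-sym A e))) , ug , uf

EqV-trans : ∀ {Γ} A {a b c : Val Γ A} → EqV A a b → EqV A b c → EqV A a c
EqV-trans ι       e            e′            = trans e e′
EqV-trans (A ⇒ B) (c , uf , _) (c′ , _ , uh) =
  (λ w e → EqV-trans B (c w e) (c′ w (EqV-trans A (EqV-sym A e) e))) , uf , uh

EqV-reflˡ : ∀ {Γ} A {a b : Val Γ A} → EqV A a b → EqV A a a
EqV-reflˡ A e = EqV-trans A e (EqV-sym A e)

EqV-reflʳ : ∀ {Γ} A {a b : Val Γ A} → EqV A a b → EqV A b b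
EqV-reflʳ A e = EqV-trans A (EqV-sym A e) e

renV-EqV : ∀ {Γ Δ} A (w : Ren Γ Δ) {a b : Val Γ A} → EqV A a b →
           EqV A (renV A w a) (renV A w b)
renV-EqV ι       w e             = cong (renNf w) e
renV-EqV (A ⇒ B) w (c , uf , ug) =
  (λ w′ → c (λ x → w′ (w x))) ,
  (λ w′ → uf (λ x → w′ (w x))) ,
  (λ w′ → ug (λ x → w′ (w x)))

renV-renV : ∀ {Γ Δ Θ} A (w : Ren Γ Δ) (w′ : Ren Δ Θ) {a : Val Γ A} → EqV A a a →
            EqV A (renV A w′ (renV A w a)) (renV A (λ x → w′ (w x)) a)
renV-renV ι       w w′ {a} e = renNf-renNf w w′ a
renV-renV (A ⇒ B) w w′ e     = renV-EqV (A ⇒ B) (λ x → w′ (w x)) e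

renV-id : ∀ {Γ} A {a : Val Γ A} → EqV A a a → EqV A (renV A (λ x → x) a) a
renV-id ι       {a} e = renNf-id a
renV-id (A ⇒ B)     e = e

mutual
  reflect : ∀ {Γ} A → Ne Γ A → Val Γ A
  reflect ι       n = nne n
  reflect (A ⇒ B) n = λ w a → reflect B (napp (renNe w n) (reify A a))

  reify : ∀ {Γ} A → Val Γ A → Nf Γ A
  reify ι       v = v
  reify (A ⇒ B) f = nlam (reify B (f vs (reflect A (nvar vz))))

mutual
  reflect-EqV : ∀ {Γ} A (n : Ne Γ A) → EqV A (reflect A n) (reflect A n)
  reflect-EqV ι       n = refl
  reflect-EqV (A ⇒ B) n =
    (λ w e → reflect-cong B (cong (napp (renNe w n)) (reify-EqV A e))) , uniform , uniform
    where
    uniform : Uniform A B (reflect (A ⇒ B) n)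
    uniform w w′ a e = EqV-trans B (renV-reflect B w′ _)
      (reflect-cong B (cong₂ napp (renNe-renNe w w′ n) (reify-renV A w′ e)))

  reflect-cong : ∀ {Γ} A {n n′ : Ne Γ A} → n ≡ n′ → EqV A (reflect A n) (reflect A n′)
  reflect-cong A {n} refl = reflect-EqV A n

  reify-EqV : ∀ {Γ} A {a b : Val Γ A} → EqV A a b → reify A a ≡ reify A b
  reify-EqV ι       e       = e
  reify-EqV (A ⇒ B) (c , _) = cong nlam (reify-EqV B (c vs (reflect-EqV A (nvar vz))))

  renV-reflect : ∀ {Γ Δ} A (w : Ren Γ Δ) (n : Ne Γ A) →
                 EqV A (renV A w (reflect A n)) (reflect A (renNe w n))
  renV-reflect ι       w n = refl
  renV-reflect (A ⇒ B) w n =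
    (λ w′ e → reflect-cong B (cong₂ napp (sym (renNe-renNe w w′ n)) (reify-EqV A e))) ,
    uniformˡ (renV-EqV (A ⇒ B) w (reflect-EqV (A ⇒ B) n)) ,
    uniformˡ (reflect-EqV (A ⇒ B) (renNe w n))

  reify-renV : ∀ {Γ Δ} A (w : Ren Γ Δ) {a : Val Γ A} → EqV A a a →
               renNf w (reify A a) ≡ reify A (renV A w a)
  reify-renV ι       w e            = refl
  reify-renV (A ⇒ B) w (c , uf , _) = cong nlam (trans
    (reify-renV B (ext w) (c vs (reflect-EqV A (nvar vz))))
    (reify-EqV B (EqV-trans B (uf vs (ext w) _ (reflect-EqV A (nvar vz)))
      (c (λ x → vs (w x)) (renV-reflect A (ext w) (nvar vz))))))

Env : Ctx → Ctx → Set
Env Γ Δ = ∀ {A} → Γ ∋ A → Val Δ A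

EqE : ∀ {Γ Δ} → Env Γ Δ → Env Γ Δ → Set
EqE {Γ} ρ ρ′ = ∀ {A} (x : Γ ∋ A) → EqV A (ρ x) (ρ′ x)

renE : ∀ {Γ Δ Δ′} → Ren Δ Δ′ → Env Γ Δ → Env Γ Δ′
renE w ρ {A} x = renV A w (ρ x)

extE : ∀ {Γ Δ A} → Env Γ Δ → Val Δ A → Env (A ∷ Γ) Δ
extE ρ a vz     = a
extE ρ a (vs x) = ρ x

eval : ∀ {Γ Δ A} → Tm Γ A → Env Γ Δ → Val Δ A
eval (var x)   ρ = ρ x
eval (lam t)   ρ = λ w a → eval t (extE (renE w ρ) a)
eval (app t u) ρ = eval t ρ (λ x → x) (eval u ρ)

EqE-sym : ∀ {Γ Δ} {ρ ρ′ : Env Γ Δ} → EqE ρ ρ′ → EqE ρ′ ρ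
EqE-sym e x = EqV-sym _ (e x)

EqE-reflˡ : ∀ {Γ Δ} {ρ ρ′ : Env Γ Δ} → EqE ρ ρ′ → EqE ρ ρ
EqE-reflˡ e x = EqV-reflˡ _ (e x)

extE-EqE : ∀ {Γ Δ A} {ρ ρ′ : Env Γ Δ} {a b : Val Δ A} → EqE ρ ρ′ → EqV A a b →
           EqE (extE ρ a) (extE ρ′ b)
extE-EqE e e′ vz     = e′
extE-EqE e e′ (vs x) = e x

renE-EqE : ∀ {Γ Δ Δ′} (w : Ren Δ Δ′) {ρ ρ′ : Env Γ Δ} → EqE ρ ρ′ →
           EqE (renE w ρ) (renE w ρ′)
renE-EqE w e x = renV-EqV _ w (e x)

mutual
  eval-cong : ∀ {Γ Δ A} (t : Tm Γ A) {ρ ρ′ : Env Γ Δ} → EqE ρ ρ′ →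
              EqV A (eval t ρ) (eval t ρ′)
  eval-cong (var x)   e = e x
  eval-cong (app t u) e = proj₁ (eval-cong t e) (λ x → x) (eval-cong u e)
  eval-cong {A = A ⇒ B} (lam t) e =
    (λ w e′ → eval-cong t (extE-EqE (renE-EqE w e) e′)) ,
    uniform (EqE-reflˡ e) , uniform (EqE-reflˡ (EqE-sym e))
    where
    uniform : ∀ {ρ : Env _ _} → EqE ρ ρ → Uniform A B (eval (lam t) ρ)
    uniform e₀ w w′ a ea = EqV-trans B (eval-renV t w′ (extE-EqE (renE-EqE w e₀) ea))
      (eval-cong t (λ { vz → renV-EqV A w′ ea ; (vs x) → renV-renV _ w w′ (e₀ x) }))

  eval-renV : ∀ {Γ Δ Δ′ A} (t : Tm Γ A) (w : Ren Δ Δ′) {ρ : Env Γ Δ} → EqE ρ ρ →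
              EqV A (renV A w (eval t ρ)) (eval t (renE w ρ))
  eval-renV (var x) w e = renV-EqV _ w (e x)
  eval-renV {A = B} (app t u) w {ρ} e =
    EqV-trans B (uniformˡ (eval-cong t e) (λ x → x) w (eval u ρ) (eval-cong u e))
      (proj₁ (eval-renV t w e) (λ x → x) (eval-renV u w e))
  eval-renV (lam t) w e =
    (λ w′ e′ → eval-cong t (extE-EqE (λ x → EqV-sym _ (renV-renV _ w w′ (e x))) e′)) ,
    uniformˡ (renV-EqV _ w (eval-cong (lam t) e)) ,
    uniformˡ (eval-cong (lam t) (renE-EqE w e))

eval-ren : ∀ {Γ Γ′ Δ A} (t : Tm Γ A) (r : Ren Γ Γ′) {ρ ρ′ : Env Γ′ Δ} → EqE ρ ρ′ →
           EqV A (eval (ren r t) ρ) (eval t (λ x → ρ′ (r x)))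
eval-ren (var x)   r e = e (r x)
eval-ren (app t u) r e = proj₁ (eval-ren t r e) (λ x → x) (eval-ren u r e)
eval-ren (lam t)   r {ρ′ = ρ′} e =
  (λ w e′ → EqV-trans _ (eval-ren t (ext r) (extE-EqE (renE-EqE w e) e′))
     (eval-cong t (λ { vz     → EqV-reflʳ _ e′
                     ; (vs x) → renV-EqV _ w (EqV-reflʳ _ (e (r x))) }))) ,
  uniformˡ (eval-cong (lam (ren (ext r) t)) (EqE-reflˡ e)) ,
  uniformˡ (eval-cong (lam t) {ρ = λ x → ρ′ (r x)} (λ x → EqV-reflʳ _ (e (r x))))

eval-sub : ∀ {Γ Γ′ Δ A} (t : Tm Γ A) (s : Sub Γ Γ′) {ρ ρ′ : Env Γ′ Δ} → EqE ρ ρ′ →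
           EqV A (eval (sub s t) ρ) (eval t (λ x → eval (s x) ρ′))
eval-sub (var x)   s e = eval-cong (s x) e
eval-sub (app t u) s e = proj₁ (eval-sub t s e) (λ x → x) (eval-sub u s e)
eval-sub (lam t)   s {ρ′ = ρ′} e =
  (λ w e′ → EqV-trans _ (eval-sub t (exts s) (extE-EqE (renE-EqE w e) e′))
    (eval-cong t (λ { vz     → EqV-reflʳ _ e′
                    ; (vs x) → EqV-trans _
                        (eval-ren (s x) vs
                          (extE-EqE (renE-EqE w (EqE-reflˡ (EqE-sym e))) (EqV-reflʳ _ e′)))
                        (EqV-sym _ (eval-renV (s x) w (EqE-reflˡ (EqE-sym e)))) }))) ,
  uniformˡ (eval-cong (lam (sub (exts s) t)) (EqE-reflˡ e)) ,
  uniformˡ (eval-cong (lam t) {ρ = λ x → eval (s x) ρ′}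
    (λ x → eval-cong (s x) (EqE-reflˡ (EqE-sym e))))

eval-resp-≈ : ∀ {Γ Δ A} {t u : Tm Γ A} → t ≈ u → {ρ ρ′ : Env Γ Δ} → EqE ρ ρ′ →
              EqV A (eval t ρ) (eval u ρ′)
eval-resp-≈ {t = t} ≈-refl e = eval-cong t e
eval-resp-≈ (≈-sym p)     e = EqV-sym _ (eval-resp-≈ p (EqE-sym e))
eval-resp-≈ (≈-trans p q) e = EqV-trans _ (eval-resp-≈ p (EqE-reflˡ e)) (eval-resp-≈ q e)
eval-resp-≈ (lam-cong {t = t} {u} p) e =
  (λ w e′ → eval-resp-≈ p (extE-EqE (renE-EqE w e) e′)) ,
  uniformˡ (eval-cong (lam t) (EqE-reflˡ e)) ,
  uniformˡ (eval-cong (lam u) (EqE-reflˡ (EqE-sym e)))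
eval-resp-≈ (app-cong p q) e = proj₁ (eval-resp-≈ p e) (λ x → x) (eval-resp-≈ q e)
eval-resp-≈ (β t u) e = EqV-sym _ (EqV-trans _
  (eval-sub t _ (EqE-sym e))
  (eval-cong t (λ { vz     → eval-cong u (EqE-reflˡ e)
                  ; (vs x) → EqV-sym _ (renV-id _ (EqE-reflˡ e x)) })))
eval-resp-≈ (η t) e =
  (λ w e′ → EqV-trans _ (proj₁ (eval-cong t e) w e′)
     (EqV-sym _ (proj₁ (EqV-trans _
        (eval-ren t vs (extE-EqE (renE-EqE w (EqE-reflˡ (EqE-sym e))) (EqV-reflʳ _ e′)))
        (EqV-sym _ (eval-renV t w (EqE-reflˡ (EqE-sym e))))) (λ x → x) (EqV-reflʳ _ e′)))) ,
  uniformˡ (eval-cong t (EqE-reflˡ e)) ,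
  uniformˡ (eval-cong (lam (app (ren vs t) (var vz))) (EqE-reflˡ (EqE-sym e)))

idE : ∀ {Γ} → Env Γ Γ
idE {A = A} x = reflect A (nvar x)

idE-EqE : ∀ {Γ} → EqE (idE {Γ}) idE
idE-EqE x = reflect-EqV _ (nvar x)

nf : ∀ {Γ A} → Tm Γ A → Nf Γ A
nf {A = A} t = reify A (eval t idE)

nf-resp-≈ : ∀ {Γ A} {t u : Tm Γ A} → t ≈ u → nf t ≡ nf u
nf-resp-≈ p = reify-EqV _ (eval-resp-≈ p idE-EqE)

-- The logical relation between terms and values that yields t ≈ ⌜ nf t ⌝.

R : ∀ {Γ} A → Tm Γ A → Val Γ A → Set
R ι       t n = t ≈ ⌜ n ⌝
R {Γ} (A ⇒ B) t f = ∀ {Δ} (w : Ren Γ Δ) {u a} → R A u a → R B (app (ren w t) u) (f w a)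

R-resp-≈ : ∀ {Γ} A {t t′ : Tm Γ A} {a} → t ≈ t′ → R A t a → R A t′ a
R-resp-≈ ι       p r     = ≈-trans (≈-sym p) r
R-resp-≈ (A ⇒ B) p r w q = R-resp-≈ B (app-cong (ren-resp-≈ w p) ≈-refl) (r w q)

R-ren : ∀ {Γ Δ} A (w : Ren Γ Δ) {t a} → R A t a → R A (ren w t) (renV A w a)
R-ren ι       w {a = a} r  = ≈-trans (ren-resp-≈ w r) (≡⇒≈ (sym (⌜renNf⌝ w a)))
R-ren (A ⇒ B) w {t} r w′ q =
  R-resp-≈ B (app-cong (≡⇒≈ (sym (ren-ren w w′ t))) ≈-refl) (r (λ x → w′ (w x)) q)

mutual
  reflect-R : ∀ {Γ} A {t : Tm Γ A} {n} → t ≈ ⌜ n ⌝ne → R A t (reflect A n)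
  reflect-R ι       p = p
  reflect-R (A ⇒ B) {n = n} p w q = reflect-R B (app-cong
    (≈-trans (ren-resp-≈ w p) (≡⇒≈ (sym (⌜renNe⌝ w n)))) (reify-R A q))

  reify-R : ∀ {Γ} A {t : Tm Γ A} {a} → R A t a → t ≈ ⌜ reify A a ⌝
  reify-R ι       r = r
  reify-R (A ⇒ B) {t} r = ≈-trans (η t) (lam-cong (reify-R B (r vs (reflect-R A ≈-refl))))

sub-R : ∀ {Γ Δ A} (t : Tm Γ A) (s : Sub Γ Δ) (ρ : Env Γ Δ) →
        (∀ {C} (x : Γ ∋ C) → R C (s x) (ρ x)) → R A (sub s t) (eval t ρ)
sub-R (var x) s ρ h = h x
sub-R {A = B} (app t u) s ρ h =
  R-resp-≈ B (app-cong (≡⇒≈ (ren-id (sub s t))) ≈-refl)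
    (sub-R t s ρ h (λ x → x) (sub-R u s ρ h))
sub-R {A = A ⇒ B} (lam t) s ρ h w {u} {a} q =
  R-resp-≈ B (≈-sym (≈-trans (β _ u) (≡⇒≈ eq)))
    (sub-R t _ (extE (renE w ρ) a) (λ { vz → q ; (vs x) → R-ren _ w (h x) }))
  where
  eq : sub0 (ren (ext w) (sub (exts s) t)) u ≡ sub (λ { vz → u ; (vs x) → ren w (s x) }) t
  eq = trans (sub-ren (ext w) _ (sub (exts s) t))
       (trans (sub-sub (exts s) _ t)
       (sub-cong (λ { vz → refl ; (vs x) → trans (sub-ren vs _ (s x)) (sub-var w (s x)) }) t))

≈-nf : ∀ {Γ A} (t : Tm Γ A) → t ≈ ⌜ nf t ⌝
≈-nf {A = A} t = ≈-trans (≡⇒≈ (sym (sub-id t)))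
  (reify-R A (sub-R t var idE (λ x → reflect-R _ ≈-refl)))

nf-injective : ∀ {Γ A} {t u : Tm Γ A} → nf t ≡ nf u → t ≈ u
nf-injective {t = t} {u} e =
  ≈-trans (≈-nf t) (≈-trans (≡⇒≈ (cong ⌜_⌝ e)) (≈-sym (≈-nf u)))

-- Spines

∃Var : Ctx → Set
∃Var Θ = Σ Ty (Θ ∋_)

⟨_⟩ : ∀ {Θ A} → Θ ∋ A → ∃Var Θ
⟨ x ⟩ = -, x

data NfArgs (Γ : Ctx) : List Ty → Set where
  []  : NfArgs Γ []
  _∷_ : ∀ {A As} → Nf Γ A → NfArgs Γ As → NfArgs Γ (A ∷ As)

nfArgs : ∀ {Γ As} → Args Γ As → NfArgs Γ As
nfArgs []       = []
nfArgs (M ∷ Ms) = nf M ∷ nfArgs Ms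

∷-injective : ∀ {Γ A As} {m m′ : Nf Γ A} {ms ms′ : NfArgs Γ As} →
              m ∷ ms ≡ m′ ∷ ms′ → m ≡ m′ × ms ≡ ms′
∷-injective refl = refl , refl

nfArgs-injective : ∀ {Γ As} (Ps Ps′ : Args Γ As) → nfArgs Ps ≡ nfArgs Ps′ → ArgsEq Ps Ps′
nfArgs-injective []       []         _ = []
nfArgs-injective (P ∷ Ps) (P′ ∷ Ps′) e =
  nf-injective (proj₁ (∷-injective e)) ∷ nfArgs-injective Ps Ps′ (proj₂ (∷-injective e))

neApps : ∀ {Γ} A → Ne Γ A → NfArgs Γ (args A) → Ne Γ ι
neApps ι       n []       = n
neApps (A ⇒ B) n (m ∷ ms) = neApps B (napp n m) ms

head : ∀ {Γ A} → Ne Γ A → ∃Var Γ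
head (nvar x)   = ⟨ x ⟩
head (napp n m) = head n

head-neApps : ∀ {Γ} A (n : Ne Γ A) ms → head (neApps A n ms) ≡ head n
head-neApps ι       n []       = refl
head-neApps (A ⇒ B) n (m ∷ ms) = head-neApps B (napp n m) ms

neApps-injectiveˡ : ∀ {Γ} A (n n′ : Ne Γ A) ms →
                    neApps A n ms ≡ neApps A n′ ms → n ≡ n′
neApps-injectiveˡ ι       n n′ []       e = e
neApps-injectiveˡ (A ⇒ B) n n′ (m ∷ ms) e with neApps-injectiveˡ B _ _ ms e
... | refl = refl

neApps-injectiveʳ : ∀ {Γ} A (n n′ : Ne Γ A) ms ms′ →
                    neApps A n ms ≡ neApps A n′ ms′ → ms ≡ ms′
neApps-injectiveʳ ι       n n′ []       []         e = refl
neApps-injectiveʳ (A ⇒ B) n n′ (m ∷ ms) (m′ ∷ ms′) e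
  with neApps-injectiveʳ B _ _ ms ms′ e
... | refl with neApps-injectiveˡ B (napp n m) (napp n′ m′) ms e
...   | refl = refl

nf-apps : ∀ {Γ} A (t : Tm Γ A) (n : Ne Γ A) (Ps : Args Γ (args A)) →
          EqV A (eval t idE) (reflect A n) → nf (apps t Ps) ≡ nne (neApps A n (nfArgs Ps))
nf-apps ι       t n []       e = e
nf-apps (C ⇒ D) t n (P ∷ Ps) e = nf-apps D (app t P) (napp n (nf P)) Ps
  (EqV-trans D (proj₁ e (λ x → x) (eval-cong P idE-EqE))
    (reflect-cong D (cong (λ m → napp m (nf P)) (renNe-id n))))

nf-apps-var : ∀ {Γ A} (h : Γ ∋ A) (Ps : Args Γ (args A)) →
              nf (apps (var h) Ps) ≡ nne (neApps A (nvar h) (nfArgs Ps))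
nf-apps-var {A = A} h Ps = nf-apps A (var h) (nvar h) Ps (reflect-EqV A (nvar h))

nne-injective : ∀ {Γ} {n n′ : Ne Γ ι} → nne n ≡ nne n′ → n ≡ n′
nne-injective refl = refl

≈-neApps : ∀ {Θ A A′} (h : Θ ∋ A) (h′ : Θ ∋ A′) (Ps : Args Θ (args A))
           (Ps′ : Args Θ (args A′)) →
           apps (var h) Ps ≈ apps (var h′) Ps′ →
           neApps A (nvar h) (nfArgs Ps) ≡ neApps A′ (nvar h′) (nfArgs Ps′)
≈-neApps h h′ Ps Ps′ e =
  nne-injective (trans (sym (nf-apps-var h Ps)) (trans (nf-resp-≈ e) (nf-apps-var h′ Ps′)))

apps-var-injectiveˡ : ∀ {Θ A A′} (h : Θ ∋ A) (h′ : Θ ∋ A′)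
                      (Ps : Args Θ (args A)) (Ps′ : Args Θ (args A′)) →
                      apps (var h) Ps ≈ apps (var h′) Ps′ → ⟨ h ⟩ ≡ ⟨ h′ ⟩
apps-var-injectiveˡ {A = A} {A′} h h′ Ps Ps′ e = begin
  ⟨ h ⟩                                    ≡⟨ head-neApps A (nvar h) (nfArgs Ps) ⟨
  head (neApps A (nvar h) (nfArgs Ps))     ≡⟨ cong head (≈-neApps h h′ Ps Ps′ e) ⟩
  head (neApps A′ (nvar h′) (nfArgs Ps′))  ≡⟨ head-neApps A′ (nvar h′) (nfArgs Ps′) ⟩
  ⟨ h′ ⟩                                   ∎
  where open ≡-Reasoning

apps-var-injectiveʳ : ∀ {Θ A} (h : Θ ∋ A) (Ps Ps′ : Args Θ (args A)) →
                      apps (var h) Ps ≈ apps (var h) Ps′ → ArgsEq Ps Ps′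
apps-var-injectiveʳ {A = A} h Ps Ps′ e =
  nfArgs-injective Ps Ps′ (neApps-injectiveʳ A (nvar h) (nvar h) _ _ (≈-neApps h h Ps Ps′ e))

∋-++⁺ˡ : ∀ Θ {Λ} → Ren Θ (Θ ++ Λ)
∋-++⁺ˡ (C ∷ Θ) vz     = vz
∋-++⁺ˡ (C ∷ Θ) (vs x) = vs (∋-++⁺ˡ Θ x)

∋-++⁺ʳ : ∀ Θ {Λ} → Ren Λ (Θ ++ Λ)
∋-++⁺ʳ []      x = x
∋-++⁺ʳ (C ∷ Θ) x = vs (∋-++⁺ʳ Θ x)

data ++-View (Θ Λ : Ctx) : ∀ {C} → (Θ ++ Λ) ∋ C → Set where
  inˡ : ∀ {C} (x : Θ ∋ C) → ++-View Θ Λ (∋-++⁺ˡ Θ x)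
  inʳ : ∀ {C} (z : Λ ∋ C) → ++-View Θ Λ (∋-++⁺ʳ Θ z)

++-view : ∀ Θ {Λ C} (x : (Θ ++ Λ) ∋ C) → ++-View Θ Λ x
++-view []      x  = inʳ x
++-view (D ∷ Θ) vz = inˡ vz
++-view (D ∷ Θ) (vs x) with ++-view Θ x
... | inˡ y = inˡ (vs y)
... | inʳ z = inʳ z

copair-++ : ∀ Θ {Λ Φ} → Ren Θ Φ → Ren Λ Φ → Ren (Θ ++ Λ) Φ
copair-++ []      f g x      = g x
copair-++ (C ∷ Θ) f g vz     = f vz
copair-++ (C ∷ Θ) f g (vs x) = copair-++ Θ (λ y → f (vs y)) g x

copair-++-⁺ˡ : ∀ Θ {Λ Φ} (f : Ren Θ Φ) (g : Ren Λ Φ) {C} (x : Θ ∋ C) →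
               copair-++ Θ f g (∋-++⁺ˡ Θ {Λ} x) ≡ f x
copair-++-⁺ˡ (C ∷ Θ) f g vz     = refl
copair-++-⁺ˡ (C ∷ Θ) f g (vs x) = copair-++-⁺ˡ Θ (λ y → f (vs y)) g x

copair-++-⁺ʳ : ∀ Θ {Λ Φ} (f : Ren Θ Φ) (g : Ren Λ Φ) {C} (z : Λ ∋ C) →
               copair-++ Θ f g (∋-++⁺ʳ Θ z) ≡ g z
copair-++-⁺ʳ []      f g z = refl
copair-++-⁺ʳ (C ∷ Θ) f g z = copair-++-⁺ʳ Θ (λ y → f (vs y)) g z

⟨vs⟩-injective : ∀ {Θ D A B} {x : Θ ∋ A} {y : Θ ∋ B} →
                 ⟨ vs {B = D} x ⟩ ≡ ⟨ vs y ⟩ → ⟨ x ⟩ ≡ ⟨ y ⟩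
⟨vs⟩-injective refl = refl

⟨⁺ˡ⟩-injective : ∀ Θ {Λ A B} (x : Θ ∋ A) (y : Θ ∋ B) →
                 ⟨ ∋-++⁺ˡ Θ {Λ} x ⟩ ≡ ⟨ ∋-++⁺ˡ Θ y ⟩ → ⟨ x ⟩ ≡ ⟨ y ⟩
⟨⁺ˡ⟩-injective (D ∷ Θ)     vz     vz     e = refl
⟨⁺ˡ⟩-injective (D ∷ Θ)     vz     (vs y) ()
⟨⁺ˡ⟩-injective (D ∷ Θ)     (vs x) vz     ()
⟨⁺ˡ⟩-injective (D ∷ Θ) {Λ} (vs x) (vs y) e
  with ⟨⁺ˡ⟩-injective Θ {Λ} x y (⟨vs⟩-injective e)
... | refl = refl

⟨⁺ˡ⟩≢⟨⁺ʳ⟩ : ∀ Θ {Λ A B} (x : Θ ∋ A) (z : Λ ∋ B) →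
            ⟨ ∋-++⁺ˡ Θ x ⟩ ≡ ⟨ ∋-++⁺ʳ Θ z ⟩ → ⊥
⟨⁺ˡ⟩≢⟨⁺ʳ⟩ (D ∷ Θ) vz     z ()
⟨⁺ˡ⟩≢⟨⁺ʳ⟩ (D ∷ Θ) (vs x) z e = ⟨⁺ˡ⟩≢⟨⁺ʳ⟩ Θ x z (⟨vs⟩-injective e)

liftSub-⁺ˡ : ∀ Ξ {Γ Δ} (s : Sub Γ Δ) {C} (x : Ξ ∋ C) →
             liftSub Ξ s (∋-++⁺ˡ Ξ x) ≡ var (∋-++⁺ˡ Ξ x)
liftSub-⁺ˡ (C ∷ Ξ) s vz     = refl
liftSub-⁺ˡ (C ∷ Ξ) s (vs x) = cong (ren vs) (liftSub-⁺ˡ Ξ s x)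

liftSub-⁺ʳ : ∀ Ξ {Γ Δ} (s : Sub Γ Δ) {C} (x : Γ ∋ C) →
             liftSub Ξ s (∋-++⁺ʳ Ξ x) ≡ ren (∋-++⁺ʳ Ξ) (s x)
liftSub-⁺ʳ []      s x = sym (ren-id (s x))
liftSub-⁺ʳ (C ∷ Ξ) s x =
  trans (cong (ren vs) (liftSub-⁺ʳ Ξ s x)) (ren-ren (∋-++⁺ʳ Ξ) vs (s x))

apps-var-⁺ˡ-sameHead : ∀ Ξ {Λ Λ′ A B} (a : Ξ ∋ A) (b : Ξ ∋ B)
                       (Ms : Args (Ξ ++ Λ′) (args A)) (Ns : Args (Ξ ++ Λ′) (args B)) →
                       apps (var (∋-++⁺ˡ Ξ a)) Ms ≈ apps (var (∋-++⁺ˡ Ξ b)) Ns →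
                       SameHead (∋-++⁺ˡ Ξ {Λ} a) (∋-++⁺ˡ Ξ b) Ms Ns
apps-var-⁺ˡ-sameHead Ξ {Λ′ = Λ′} a b Ms Ns e
  with ⟨⁺ˡ⟩-injective Ξ {Λ′} a b (apps-var-injectiveˡ _ _ Ms Ns e)
... | refl = same (apps-var-injectiveʳ _ Ms Ns e)

-- Abstracting the arguments of B over Θ leaves the body in args B ʳ++ Θ,
-- with the last argument as the innermost variable.

∋-ʳ++⁺ʳ : ∀ Λ {Θ} → Ren Θ (Λ ʳ++ Θ)
∋-ʳ++⁺ʳ []      x = x
∋-ʳ++⁺ʳ (C ∷ Λ) x = ∋-ʳ++⁺ʳ Λ (vs x)

∋-ʳ++⁺ˡ : ∀ Λ {Θ} → Ren Λ (Λ ʳ++ Θ)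
∋-ʳ++⁺ˡ (C ∷ Λ) vz     = ∋-ʳ++⁺ʳ Λ vz
∋-ʳ++⁺ˡ (C ∷ Λ) (vs z) = ∋-ʳ++⁺ˡ Λ z

copair-ʳ++ : ∀ Λ {Θ Φ} → Ren Λ Φ → Ren Θ Φ → Ren (Λ ʳ++ Θ) Φ
copair-ʳ++ []      f g = g
copair-ʳ++ (C ∷ Λ) f g = copair-ʳ++ Λ (λ z → f (vs z)) (λ { vz → f vz ; (vs x) → g x })

copair-ʳ++-⁺ʳ : ∀ Λ {Θ Φ} (f : Ren Λ Φ) (g : Ren Θ Φ) {C} (x : Θ ∋ C) →
                copair-ʳ++ Λ f g (∋-ʳ++⁺ʳ Λ x) ≡ g x
copair-ʳ++-⁺ʳ []      f g x = refl
copair-ʳ++-⁺ʳ (C ∷ Λ) f g x = copair-ʳ++-⁺ʳ Λ (λ z → f (vs z)) _ (vs x)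

copair-ʳ++-⁺ˡ : ∀ Λ {Θ Φ} (f : Ren Λ Φ) (g : Ren Θ Φ) {C} (z : Λ ∋ C) →
                copair-ʳ++ Λ f g (∋-ʳ++⁺ˡ Λ {Θ} z) ≡ f z
copair-ʳ++-⁺ˡ (C ∷ Λ) f g vz     = copair-ʳ++-⁺ʳ Λ (λ z → f (vs z)) _ vz
copair-ʳ++-⁺ˡ (C ∷ Λ) f g (vs z) = copair-ʳ++-⁺ˡ Λ (λ z → f (vs z)) _ z

exts-ʳ++ : ∀ Λ {Θ Θ′} → Sub Θ Θ′ → Sub (Λ ʳ++ Θ) (Λ ʳ++ Θ′)
exts-ʳ++ []      s = s
exts-ʳ++ (C ∷ Λ) s = exts-ʳ++ Λ (exts s)

exts-ʳ++-⁺ʳ : ∀ Λ {Θ Θ′} (s : Sub Θ Θ′) {C} (x : Θ ∋ C) →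
              exts-ʳ++ Λ s (∋-ʳ++⁺ʳ Λ x) ≡ ren (∋-ʳ++⁺ʳ Λ) (s x)
exts-ʳ++-⁺ʳ []      s x = sym (ren-id (s x))
exts-ʳ++-⁺ʳ (C ∷ Λ) s x =
  trans (exts-ʳ++-⁺ʳ Λ (exts s) (vs x)) (ren-ren vs (∋-ʳ++⁺ʳ Λ) (s x))

exts-ʳ++-⁺ˡ : ∀ Λ {Θ Θ′} (s : Sub Θ Θ′) {C} (z : Λ ∋ C) →
              exts-ʳ++ Λ s (∋-ʳ++⁺ˡ Λ z) ≡ var (∋-ʳ++⁺ˡ Λ z)
exts-ʳ++-⁺ˡ (C ∷ Λ) s vz     = exts-ʳ++-⁺ʳ Λ (exts s) vz
exts-ʳ++-⁺ˡ (C ∷ Λ) s (vs z) = exts-ʳ++-⁺ˡ Λ (exts s) z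

lams : ∀ B {Θ} → Tm (args B ʳ++ Θ) ι → Tm Θ B
lams ι       t = t
lams (C ⇒ D) t = lam (lams D t)

lams-resp-≈ : ∀ B {Θ} {t u : Tm (args B ʳ++ Θ) ι} → t ≈ u → lams B t ≈ lams B u
lams-resp-≈ ι       e = e
lams-resp-≈ (C ⇒ D) e = lam-cong (lams-resp-≈ D e)

lams-injective : ∀ B {Θ} {t u : Tm (args B ʳ++ Θ) ι} → lams B t ≈ lams B u → t ≈ u
lams-injective ι       e = e
lams-injective (C ⇒ D) e = lams-injective D (lam-injective e)

sub-lams : ∀ B {Θ Θ′} (s : Sub Θ Θ′) (t : Tm (args B ʳ++ Θ) ι) →
           sub s (lams B t) ≡ lams B (sub (exts-ʳ++ (args B) s) t)
sub-lams ι       s t = refl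
sub-lams (C ⇒ D) s t = cong lam (sub-lams D (exts s) t)

spine : ∀ {Θ} A → Tm Θ A → (∀ {C} → args A ∋ C → Tm Θ C) → Tm Θ ι
spine ι       M f = M
spine (C ⇒ D) M f = spine D (app M (f vz)) (λ i → f (vs i))

spine-cong : ∀ {Θ} A {M M′ : Tm Θ A} {f g : ∀ {C} → args A ∋ C → Tm Θ C} →
             M ≡ M′ → (∀ {C} (i : args A ∋ C) → f i ≡ g i) →
             spine A M f ≡ spine A M′ g
spine-cong ι       eM ef = eM
spine-cong (C ⇒ D) eM ef = spine-cong D (cong₂ app eM (ef vz)) (λ i → ef (vs i))

spine-resp-≈ : ∀ {Θ} A {M M′ : Tm Θ A} (f : ∀ {C} → args A ∋ C → Tm Θ C) →
               M ≈ M′ → spine A M f ≈ spine A M′ f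
spine-resp-≈ ι       f e = e
spine-resp-≈ (C ⇒ D) f e = spine-resp-≈ D (λ i → f (vs i)) (app-cong e ≈-refl)

sub-spine : ∀ {Θ Θ′} A (s : Sub Θ Θ′) (M : Tm Θ A)
            (f : ∀ {C} → args A ∋ C → Tm Θ C) →
            sub s (spine A M f) ≡ spine A (sub s M) (λ i → sub s (f i))
sub-spine ι       s M f = refl
sub-spine (C ⇒ D) s M f = sub-spine D s (app M (f vz)) (λ i → f (vs i))

ren-spine : ∀ {Θ Θ′} A (r : Ren Θ Θ′) (M : Tm Θ A)
            (f : ∀ {C} → args A ∋ C → Tm Θ C) →
            ren r (spine A M f) ≡ spine A (ren r M) (λ i → ren r (f i))
ren-spine ι       r M f = refl
ren-spine (C ⇒ D) r M f = ren-spine D r (app M (f vz)) (λ i → f (vs i))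

renSpine : ∀ {Θ Λ Φ} A → Ren Θ Φ → Ren Λ Φ → Tm Θ A → Sub (args A) Λ → Tm Φ ι
renSpine A f g M τ = spine A (ren f M) (λ i → ren g (τ i))

ren-renSpine : ∀ {Θ Λ Φ Ψ} A (r : Ren Φ Ψ)
               {f : Ren Θ Φ} {g : Ren Λ Φ} {f′ : Ren Θ Ψ} {g′ : Ren Λ Ψ} →
               (∀ {C} (x : Θ ∋ C) → r (f x) ≡ f′ x) →
               (∀ {C} (z : Λ ∋ C) → r (g z) ≡ g′ z) →
               (M : Tm Θ A) (τ : Sub (args A) Λ) →
               ren r (renSpine A f g M τ) ≡ renSpine A f′ g′ M τ
ren-renSpine A r {f} {g} ef eg M τ = trans (ren-spine A r _ _) (spine-cong A
  (trans (ren-ren f r M) (ren-cong ef M))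
  (λ i → trans (ren-ren g r (τ i)) (ren-cong eg (τ i))))

η-lams : ∀ A {Θ} (M : Tm Θ A) →
         M ≈ lams A (renSpine A (∋-ʳ++⁺ʳ (args A)) (∋-ʳ++⁺ˡ (args A)) M var)
η-lams ι       M = ≡⇒≈ (sym (ren-id M))
η-lams (C ⇒ D) M = ≈-trans (η M) (lam-cong (≈-trans (η-lams D (app (ren vs M) (var vz)))
  (lams-resp-≈ D (spine-resp-≈ D _
    (app-cong (≡⇒≈ (ren-ren vs (∋-ʳ++⁺ʳ (args D)) M)) ≈-refl)))))

-- M ↦ λ y⃗. M (σ y⃗)

module _ {A B : Ty} (σ : Sub (args A) (args B)) where

  precomp : ∀ {Θ} → Tm Θ A → Tm Θ B
  precomp M = lams B (renSpine A (∋-ʳ++⁺ʳ (args B)) (∋-ʳ++⁺ˡ (args B)) M σ)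

  sub-precomp : ∀ {Θ Θ′} (s : Sub Θ Θ′) (M : Tm Θ A) →
                sub s (precomp M) ≡ precomp (sub s M)
  sub-precomp s M = trans (sub-lams B s _) (cong (lams B)
    (trans (sub-spine A _ _ _) (spine-cong A
      (trans (sub-ren (∋-ʳ++⁺ʳ (args B)) _ M)
        (trans (sub-cong (exts-ʳ++-⁺ʳ (args B) s) M)
               (sym (ren-sub s (∋-ʳ++⁺ʳ (args B)) M))))
      (λ i → trans (sub-ren (∋-ʳ++⁺ˡ (args B)) _ (σ i))
        (trans (sub-cong (exts-ʳ++-⁺ˡ (args B) s) (σ i))
               (sub-var (∋-ʳ++⁺ˡ (args B)) (σ i)))))))

  sub-ren-precomp-vz : ∀ {Θ Θ′ Φ} (r : Ren Θ Θ′) (s : Sub (A ∷ Θ′) Φ) →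
                       sub s (ren (ext r) (precomp (var vz))) ≡ precomp (s vz)
  sub-ren-precomp-vz r s = trans (sub-ren (ext r) s (precomp (var vz))) (sub-precomp _ (var vz))

  hat-renSpine : ∀ Θ (M : Tm Θ A) →
                 hat Θ σ (renSpine A (∋-++⁺ˡ Θ) (∋-++⁺ʳ Θ) M var) ≡
                 renSpine A (∋-++⁺ˡ Θ) (∋-++⁺ʳ Θ) M σ
  hat-renSpine Θ M = trans (sub-spine A _ _ _) (spine-cong A
    (trans (sub-ren (∋-++⁺ˡ Θ) _ M)
      (trans (sub-cong (liftSub-⁺ˡ Θ σ) M) (sub-var (∋-++⁺ˡ Θ) M)))
    (liftSub-⁺ʳ Θ σ))

  -- Strip the λ y⃗, exchange the two blocks of the context so that σ̂ can be
  -- cancelled, and exchange back to recover M by η.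
  precomp-injective : IsInjRed σ → ∀ {Θ} {M M′ : Tm Θ A} →
                      precomp M ≈ precomp M′ → M ≈ M′
  precomp-injective σ-injective {Θ} {M} {M′} e =
    ≈-resp (≈-sym (η-lams A M)) (≈-sym (η-lams A M′)) (lams-resp-≈ A η-bodies)
    where
    toΘ++ : Ren (args B ʳ++ Θ) (Θ ++ args B)
    toΘ++ = copair-ʳ++ (args B) (∋-++⁺ʳ Θ) (∋-++⁺ˡ Θ)

    fromΘ++ : Ren (Θ ++ args A) (args A ʳ++ Θ)
    fromΘ++ = copair-++ Θ (∋-ʳ++⁺ʳ (args A)) (∋-ʳ++⁺ˡ (args A))

    σ-spines : renSpine A (∋-++⁺ˡ Θ) (∋-++⁺ʳ Θ) M σ ≈
               renSpine A (∋-++⁺ˡ Θ) (∋-++⁺ʳ Θ) M′ σ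
    σ-spines =
      ≈-resp (≡⇒≈ (moved M)) (≡⇒≈ (moved M′)) (ren-resp-≈ toΘ++ (lams-injective B e))
      where
      moved : ∀ N → ren toΘ++ (renSpine A (∋-ʳ++⁺ʳ (args B)) (∋-ʳ++⁺ˡ (args B)) N σ) ≡
                    renSpine A (∋-++⁺ˡ Θ) (∋-++⁺ʳ Θ) N σ
      moved N = ren-renSpine A toΘ++
        (copair-ʳ++-⁺ʳ (args B) _ _) (copair-ʳ++-⁺ˡ (args B) _ _) N σ

    spines : renSpine A (∋-++⁺ˡ Θ) (∋-++⁺ʳ Θ) M var ≈
             renSpine A (∋-++⁺ˡ Θ) (∋-++⁺ʳ Θ) M′ var
    spines = σ-injective Θ _ _ (≈-resp (≡⇒≈ (sym (hat-renSpine Θ M)))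
                                       (≡⇒≈ (sym (hat-renSpine Θ M′))) σ-spines)

    η-bodies : renSpine A (∋-ʳ++⁺ʳ (args A)) (∋-ʳ++⁺ˡ (args A)) M var ≈
               renSpine A (∋-ʳ++⁺ʳ (args A)) (∋-ʳ++⁺ˡ (args A)) M′ var
    η-bodies = ≈-resp (≡⇒≈ (moved M)) (≡⇒≈ (moved M′)) (ren-resp-≈ fromΘ++ spines)
      where
      moved : ∀ N → ren fromΘ++ (renSpine A (∋-++⁺ˡ Θ) (∋-++⁺ʳ Θ) N var) ≡
                    renSpine A (∋-ʳ++⁺ʳ (args A)) (∋-ʳ++⁺ˡ (args A)) N var
      moved N = ren-renSpine A fromΘ++ (copair-++-⁺ˡ Θ _ _) (copair-++-⁺ʳ Θ _ _) N var

module _ {A B : Ty} (D : Ty) (σ : Sub (args A) (args B)) where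

  liftRed : Sub ((A ⇒ D) ∷ []) ((B ⇒ D) ∷ [])
  liftRed vz = lam (app (var (vs vz)) (precomp σ (var vz)))

  liftRed-apps-⁺ˡ : ∀ Ξ {C} (a : Ξ ∋ C) Ms →
                    apps (liftSub Ξ liftRed (∋-++⁺ˡ Ξ a)) Ms ≈
                    apps (var (∋-++⁺ˡ Ξ a)) Ms
  liftRed-apps-⁺ˡ Ξ a Ms = ≡⇒≈ (cong (λ t → apps t Ms) (liftSub-⁺ˡ Ξ liftRed a))

  liftRed-apps-⁺ʳ : ∀ Ξ M Ms →
                    apps (liftSub Ξ liftRed (∋-++⁺ʳ Ξ vz)) (M ∷ Ms) ≈
                    apps (var (∋-++⁺ʳ Ξ vz)) (precomp σ M ∷ Ms)
  liftRed-apps-⁺ʳ Ξ M Ms = begin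
    apps (liftSub Ξ liftRed (∋-++⁺ʳ Ξ vz)) (M ∷ Ms)
      ≡⟨ cong (λ t → apps t (M ∷ Ms)) (liftSub-⁺ʳ Ξ liftRed vz) ⟩
    apps (app (ren (∋-++⁺ʳ Ξ) (liftRed vz)) M) Ms
      ≈⟨ apps-resp-≈ D Ms (≈-trans (β _ M)
           (app-cong ≈-refl (≡⇒≈ (sub-ren-precomp-vz σ _ _)))) ⟩
    apps (var (∋-++⁺ʳ Ξ vz)) (precomp σ M ∷ Ms)
      ∎
    where open ≈-Reasoning

  liftRed-isAtomic : IsInjRed σ → IsAtomicRed liftRed
  liftRed-isAtomic σ-injective Ξ a b Ms Ns e with ++-view Ξ a | ++-view Ξ b
  liftRed-isAtomic σ-injective Ξ _ _ Ms Ns e | inˡ a | inˡ b =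
    apps-var-⁺ˡ-sameHead Ξ a b Ms Ns
      (≈-resp (liftRed-apps-⁺ˡ Ξ a Ms) (liftRed-apps-⁺ˡ Ξ b Ns) e)
  liftRed-isAtomic σ-injective Ξ _ _ Ms (N ∷ Ns) e | inˡ a | inʳ vz =
    ⊥-elim (⟨⁺ˡ⟩≢⟨⁺ʳ⟩ Ξ a vz (apps-var-injectiveˡ _ _ Ms (precomp σ N ∷ Ns)
      (≈-resp (liftRed-apps-⁺ˡ Ξ a Ms) (liftRed-apps-⁺ʳ Ξ N Ns) e)))
  liftRed-isAtomic σ-injective Ξ _ _ (M ∷ Ms) Ns e | inʳ vz | inˡ b =
    ⊥-elim (⟨⁺ˡ⟩≢⟨⁺ʳ⟩ Ξ b vz (apps-var-injectiveˡ _ _ Ns (precomp σ M ∷ Ms)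
      (≈-resp (liftRed-apps-⁺ˡ Ξ b Ns) (liftRed-apps-⁺ʳ Ξ M Ms) (≈-sym e))))
  liftRed-isAtomic σ-injective Ξ _ _ (M ∷ Ms) (N ∷ Ns) e | inʳ vz | inʳ vz
    with apps-var-injectiveʳ _ (precomp σ M ∷ Ms) (precomp σ N ∷ Ns)
           (≈-resp (liftRed-apps-⁺ʳ Ξ M Ms) (liftRed-apps-⁺ʳ Ξ N Ns) e)
  ... | eM ∷ eMs = same (precomp-injective σ σ-injective eM ∷ eMs)

lemmaL : (A B : Ty) (Cs : List Ty) → A ≤ˢ B →
         ⟦ ⟦ A ∷ Cs ⟧ ∷ [] ⟧ ≤ᵃ ⟦ ⟦ B ∷ Cs ⟧ ∷ [] ⟧
lemmaL A B Cs (σ , σ-injective) = liftRed ⟦ Cs ⟧ σ , liftRed-isAtomic ⟦ Cs ⟧ σ σ-injective
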